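{- For all positive integers $d,k$ the following hold: (i) $\Lambda_d(k)$ determines exactly $k$ distinct $\ell^1$-distances, namely $2,4,\dots,2k$; (ii) $|\Lambda_1(k)|=k+1$ and $|\Lambda_d(1)|=2d$; (iii) $\displaystyle |\Lambda_{d+1}(k)|=|\Lambda_d(k)|+2\sum_{j=0}^{k-1}|\Lambda_d(j)|$.
   Context: For $x=(x_1,\dots,x_d)\in\mathbb{R}^d$, $\|x\|_1=|x_1|+\cdots+|x_d|$, and the $\ell^1$-distance between $x,y$ is $\|x-y\|_1$. A set $P\subseteq\mathbb{R}^d$ determines the $\ell^1$-distance $\lambda$ if $\lambda=\|x-y\|_1$ for some $x,y\in P$ with $x\neq y$ (so $0$ is never counted as a determined distance). For integers $d>0$, $k\ge 0$, $\Lambda_d(k)=\{n=(n_1,\dots,n_d)\in\mathbb{Z}^d:\ \|n\|_1\le k,\ n_1+\cdots+n_d\equiv k \pmod 2\}$. -}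

module Defs where

open import Data.Nat using (ℕ; _≤_)
open import Data.Integer using (ℤ; +_; ∣_∣; _-_; _+_)
open import Data.Integer.Divisibility using (_∣_)
open import Data.Vec using (Vec; map; zipWith; foldr)
import Data.Vec as V
open import Data.Product using (Σ; ∃; _×_)
open import Relation.Binary.PropositionalEquality using (_≡_)
open import Relation.Nullary using (¬_)

‖_‖₁ : ∀ {d} → Vec ℤ d → ℕ
‖ x ‖₁ = V.sum (map ∣_∣ x)

coordSum : ∀ {d} → Vec ℤ d → ℤ
coordSum = foldr _ _+_ (+ 0)

InΛ : (d k : ℕ) → Vec ℤ d → Set
InΛ d k n = (‖ n ‖₁ ≤ k) × ((+ 2) ∣ (coordSum n - + k))

Λ : (d k : ℕ) → Set
Λ d k = Σ (Vec ℤ d) (InΛ d k)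

dist₁ : ∀ {d} → Vec ℤ d → Vec ℤ d → ℕ
dist₁ x y = ‖ zipWith _-_ x y ‖₁

Determines : (d k : ℕ) → ℕ → Set
Determines d k λ' = ∃ λ (x : Vec ℤ d) → ∃ λ (y : Vec ℤ d) →
  InΛ d k x × InΛ d k y × ¬ (x ≡ y) × dist₁ x y ≡ λ'

module Submission where

-- Splitting a point of Λ_{d+1}(k) as a ∷ v, the point lies in
-- Λ_{d+1}(k) iff |a| ≤ k and v ∈ Λ_d(k - |a|): the norm drops by |a| and the
-- parity condition is unchanged because |a| - a is even.  Sorting by a = 0,
-- a > 0, a < 0 gives Λ_{d+1}(k) ≅ Λ_d(k) ⊎ 2 · (⨆_{j<k} Λ_d(j)), which is the
-- recursion (iii) for the counting function N below.  Λ_0(j) is a point or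
-- empty according to the parity of j; from this N d 0 = 1, N d 1 = 2d and
-- N 1 k = k + 1, i.e. (ii).
--
-- The ℓ¹-norm of an integer vector has the parity of its
-- coordinate sum, so distances inside Λ_d(k) are even; they are at most 2k by
-- the triangle inequality and nonzero for distinct points, giving the bound
-- in (i).  Conversely (t + j, 0, …) and (t - j, 0, …) realise 2j in Λ_d(t + j).

open import Defs
open import Data.Nat using (ℕ; zero; suc; _≤_; _<_; _*_; _+_; _∸_; z≤n; s≤s)
import Data.Nat.Properties as ℕP
open import Algebra.Properties.CommutativeSemigroup ℕP.+-commutativeSemigroup
  using () renaming (interchange to +-interchange)
import Data.Nat.Divisibility as ℕD
open import Data.Nat.Tactic.RingSolver as ℕRing using ()
open import Data.Integer as ℤ using (ℤ; +_; -[1+_]; ∣_∣)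
import Data.Integer.Properties as ℤP
import Data.Integer.Divisibility as ℤD
import Data.Integer.Divisibility.Signed as ℤS
open import Data.Integer.Tactic.RingSolver using (solve-∀)
open import Data.Fin using (Fin)
open import Data.Fin.Properties using (+↔⊎)
open import Data.List using (map; upTo; _∷ʳ_)
open import Data.List.Properties using (upTo-∷ʳ; map-++)
open import Data.Nat.ListAction using (sum)
open import Data.Nat.ListAction.Properties using (sum-++)
open import Data.Vec using (Vec; []; _∷_; replicate; zipWith)
open import Data.Product using (Σ; _×_; _,_; proj₁)
open import Data.Sum using (_⊎_; inj₁; inj₂)
open import Data.Sum.Function.Propositional using (_⊎-↔_)
open import Data.Empty using (⊥-elim)
open import Function.Bundles using (_↔_; _⇔_; mk↔ₛ′; mk⇔; Equivalence)
open import Function.Properties.Inverse using (↔-refl; ↔-sym; ↔-trans)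
open import Relation.Nullary using (¬_)
open import Relation.Binary.PropositionalEquality
open Equivalence using (to; from)

Fin-cong : ∀ {m n} → m ≡ n → Fin m ↔ Fin n
Fin-cong refl = ↔-refl

prop-↔ : ∀ {A B : Set} → (∀ (x y : A) → x ≡ y) → (∀ (x y : B) → x ≡ y) → A ⇔ B → A ↔ B
prop-↔ A-prop B-prop A⇔B =
  mk↔ₛ′ (to A⇔B) (from A⇔B) (λ y → B-prop _ y) (λ x → A-prop _ x)

sum-upTo-suc : (c : ℕ → ℕ) (k : ℕ) →
  sum (map c (upTo (suc k))) ≡ sum (map c (upTo k)) + c k
sum-upTo-suc c k = begin
  sum (map c (upTo (suc k)))          ≡⟨ cong (λ l → sum (map c l)) (upTo-∷ʳ k) ⟨
  sum (map c (upTo k ∷ʳ k))           ≡⟨ cong sum (map-++ c (upTo k) _) ⟩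
  sum (map c (upTo k) ∷ʳ c k)         ≡⟨ sum-++ (map c (upTo k)) _ ⟩
  sum (map c (upTo k)) + (c k + 0)    ≡⟨ cong (_+_ (sum (map c (upTo k)))) (ℕP.+-identityʳ (c k)) ⟩
  sum (map c (upTo k)) + c k          ∎
  where open ≡-Reasoning

-- The disjoint union ⨆_{j < k} P j, indexed by a = k - 1 - j.
Shells : (ℕ → Set) → ℕ → Set
Shells P k = Σ ℕ λ a → suc a ≤ k × P (k ∸ suc a)

Shells-suc : (P : ℕ → Set) (k : ℕ) → Shells P (suc k) ↔ (P k ⊎ Shells P k)
Shells-suc P k = mk↔ₛ′ split join split-join join-split
  where
  split : Shells P (suc k) → P k ⊎ Shells P k
  split (zero  , _     , p) = inj₁ p
  split (suc a , s≤s h , p) = inj₂ (a , h , p)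
  join : P k ⊎ Shells P k → Shells P (suc k)
  join (inj₁ p)           = zero , s≤s z≤n , p
  join (inj₂ (a , h , p)) = suc a , s≤s h , p
  split-join : ∀ x → split (join x) ≡ x
  split-join (inj₁ _) = refl
  split-join (inj₂ _) = refl
  join-split : ∀ x → join (split x) ≡ x
  join-split (zero  , s≤s z≤n , _) = refl
  join-split (suc a , s≤s _   , _) = refl

Shells-count : (P : ℕ → Set) (c : ℕ → ℕ) (k : ℕ) →
  (∀ j → j < k → P j ↔ Fin (c j)) → Shells P k ↔ Fin (sum (map c (upTo k)))
Shells-count P c zero    _     = mk↔ₛ′ (λ { (_ , () , _) }) (λ ()) (λ ()) (λ { (_ , () , _) })
Shells-count P c (suc k) count =
  ↔-trans (Shells-suc P k)
  (↔-trans (count k ℕP.≤-refl ⊎-↔ Shells-count P c k (λ j j<k → count j (ℕP.m≤n⇒m≤1+n j<k)))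
  (↔-trans (↔-sym +↔⊎)
  (Fin-cong (trans (ℕP.+-comm (c k) _) (sym (sum-upTo-suc c k))))))

Even : ℤ → Set
Even z = + 2 ℤD.∣ z

even-irrelevant : ∀ {z} (p q : Even z) → p ≡ q
even-irrelevant (ℕD.divides a e) (ℕD.divides b f)
  with ℕP.*-cancelʳ-≡ a b 2 (trans (sym e) f)
... | refl = cong (ℕD.divides a) (ℕP.≡-irrelevant e f)

even⇒signed : ∀ z → Even z → + 2 ℤS.∣ z
even⇒signed z = ℤS.∣ᵤ⇒∣ {k = + 2} {i = z}

even-+ : ∀ x y → Even x → Even y → Even (x ℤ.+ y)
even-+ x y p q = ℤS.∣⇒∣ᵤ {k = + 2} (ℤS.∣m∣n⇒∣m+n (even⇒signed x p) (even⇒signed y q))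

even-- : ∀ x y → Even x → Even y → Even (x ℤ.- y)
even-- x y p q = ℤS.∣⇒∣ᵤ {k = + 2} (ℤS.∣m∣n⇒∣m-n (even⇒signed x p) (even⇒signed y q))

even-double : ∀ z → Even (z ℤ.+ z)
even-double z = ℤS.∣⇒∣ᵤ {k = + 2} (ℤS.divides z (double z))
  where
  double : ∀ z → z ℤ.+ z ≡ z ℤ.* + 2
  double = solve-∀

even-shift : ∀ x e → Even e → Even (x ℤ.- e) ⇔ Even x
even-shift x e even-e = mk⇔
  (λ p → subst Even (cancel x e) (even-+ (x ℤ.- e) e p even-e))
  (λ p → even-- x e p even-e)
  where
  cancel : ∀ x e → (x ℤ.- e) ℤ.+ e ≡ x
  cancel = solve-∀

abs-minus-even : ∀ a → Even (+ ∣ a ∣ ℤ.- a)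
abs-minus-even (+ n)    = subst Even (sym (ℤP.+-inverseʳ (+ n))) (ℕD.divides 0 refl)
abs-minus-even -[1+ n ] = even-double (+ suc n)

norm-parity : ∀ {d} (z : Vec ℤ d) → Even (+ ‖ z ‖₁ ℤ.- coordSum z)
norm-parity []      = ℕD.divides 0 refl
norm-parity (a ∷ v) = subst Even regroup
  (even-+ (+ ∣ a ∣ ℤ.- a) _ (abs-minus-even a) (norm-parity v))
  where
  regroup : (+ ∣ a ∣ ℤ.- a) ℤ.+ (+ ‖ v ‖₁ ℤ.- coordSum v) ≡ + ‖ a ∷ v ‖₁ ℤ.- coordSum (a ∷ v)
  regroup = trans (interchange (+ ∣ a ∣) a (+ ‖ v ‖₁) (coordSum v))
                  (cong (ℤ._- coordSum (a ∷ v)) (sym (ℤP.pos-+ ∣ a ∣ ‖ v ‖₁)))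
    where
    interchange : ∀ m a n s → (m ℤ.- a) ℤ.+ (n ℤ.- s) ≡ (m ℤ.+ n) ℤ.- (a ℤ.+ s)
    interchange = solve-∀

InΛ-irrelevant : ∀ {d k v} (p q : InΛ d k v) → p ≡ q
InΛ-irrelevant {k = k} {v} (p₁ , p₂) (q₁ , q₂) =
  cong₂ _,_ (ℕP.≤-irrelevant p₁ q₁) (even-irrelevant {coordSum v ℤ.- + k} p₂ q₂)

Λ-≡ : ∀ {d k} {x y : Λ d k} → proj₁ x ≡ proj₁ y → x ≡ y
Λ-≡ {x = v , p} {y = .v , q} refl = cong (v ,_) (InΛ-irrelevant {v = v} p q)

cons-mem : ∀ {d} a j (v : Vec ℤ d) → InΛ (suc d) (∣ a ∣ + j) (a ∷ v) ⇔ InΛ d j v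
cons-mem a j v = mk⇔
  (λ (bound , parity) → ℕP.+-cancelˡ-≤ ∣ a ∣ _ _ bound , to same-parity parity)
  (λ (bound , parity) → ℕP.+-monoʳ-≤ ∣ a ∣ bound , from same-parity parity)
  where
  s = coordSum v
  shift : (a ℤ.+ s) ℤ.- + (∣ a ∣ + j) ≡ (s ℤ.- + j) ℤ.- (+ ∣ a ∣ ℤ.- a)
  shift = trans (cong (ℤ._-_ (a ℤ.+ s)) (ℤP.pos-+ ∣ a ∣ j)) (regroup a s (+ ∣ a ∣) (+ j))
    where
    regroup : ∀ a s m j → (a ℤ.+ s) ℤ.- (m ℤ.+ j) ≡ (s ℤ.- j) ℤ.- (m ℤ.- a)
    regroup = solve-∀
  same-parity : Even ((a ℤ.+ s) ℤ.- + (∣ a ∣ + j)) ⇔ Even (s ℤ.- + j)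
  same-parity = subst (λ z → Even z ⇔ Even (s ℤ.- + j)) (sym shift)
                      (even-shift (s ℤ.- + j) (+ ∣ a ∣ ℤ.- a) (abs-minus-even a))

head-bound : ∀ {d k} a (v : Vec ℤ d) → InΛ (suc d) k (a ∷ v) → ∣ a ∣ ≤ k
head-bound a _ (bound , _) = ℕP.m+n≤o⇒m≤o ∣ a ∣ bound

tail-mem : ∀ {d k} a (v : Vec ℤ d) → ∣ a ∣ ≤ k → InΛ (suc d) k (a ∷ v) ⇔ InΛ d (k ∸ ∣ a ∣) v
tail-mem {d} {k} a v h =
  subst (λ k′ → InΛ (suc d) k′ (a ∷ v) ⇔ InΛ d (k ∸ ∣ a ∣) v) (ℕP.m+[n∸m]≡n h) (cons-mem a _ v)

Λ-suc : ∀ d k → Λ (suc d) k ↔ (Λ d k ⊎ (Shells (Λ d) k ⊎ Shells (Λ d) k))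
Λ-suc d k = mk↔ₛ′ split join split-join join-split
  where
  split : Λ (suc d) k → Λ d k ⊎ (Shells (Λ d) k ⊎ Shells (Λ d) k)
  split ((+ zero ∷ v) , p) = inj₁ (v , to (tail-mem (+ 0) v z≤n) p)
  split ((+ suc a ∷ v) , p) = inj₂ (inj₁ (a , h , v , to (tail-mem (+ suc a) v h) p))
    where h = head-bound (+ suc a) v p
  split ((-[1+ a ] ∷ v) , p) = inj₂ (inj₂ (a , h , v , to (tail-mem -[1+ a ] v h) p))
    where h = head-bound -[1+ a ] v p
  join : Λ d k ⊎ (Shells (Λ d) k ⊎ Shells (Λ d) k) → Λ (suc d) k
  join (inj₁ (v , q))                = (+ 0 ∷ v) , from (tail-mem (+ 0) v z≤n) q
  join (inj₂ (inj₁ (a , h , v , q))) = (+ suc a ∷ v) , from (tail-mem (+ suc a) v h) q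
  join (inj₂ (inj₂ (a , h , v , q))) = (-[1+ a ] ∷ v) , from (tail-mem -[1+ a ] v h) q
  split-join : ∀ x → split (join x) ≡ x
  split-join (inj₁ _) = cong inj₁ (Λ-≡ refl)
  split-join (inj₂ (inj₁ (a , _ , _))) =
    cong₂ (λ h w → inj₂ (inj₁ (a , h , w))) (ℕP.≤-irrelevant _ _) (Λ-≡ refl)
  split-join (inj₂ (inj₂ (a , _ , _))) =
    cong₂ (λ h w → inj₂ (inj₂ (a , h , w))) (ℕP.≤-irrelevant _ _) (Λ-≡ refl)
  join-split : ∀ x → join (split x) ≡ x
  join-split ((+ zero  ∷ _) , _) = Λ-≡ refl
  join-split ((+ suc _ ∷ _) , _) = Λ-≡ refl
  join-split ((-[1+ _ ] ∷ _) , _) = Λ-≡ refl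

evenIndicator : ℕ → ℕ
evenIndicator zero          = 1
evenIndicator (suc zero)    = 0
evenIndicator (suc (suc j)) = evenIndicator j

Λ₀-prop : ∀ {j} (x y : Λ 0 j) → x ≡ y
Λ₀-prop ([] , _) ([] , _) = Λ-≡ refl

Λ₀-shift : ∀ j → Λ 0 (2 + j) ⇔ Λ 0 j
Λ₀-shift j = mk⇔
  (λ { ([] , _ , p) → [] , z≤n , to same-parity p })
  (λ { ([] , _ , p) → [] , z≤n , from same-parity p })
  where
  shift : + 0 ℤ.- + (2 + j) ≡ (+ 0 ℤ.- + j) ℤ.- + 2
  shift = trans (cong (ℤ._-_ (+ 0)) (ℤP.pos-+ 2 j)) (regroup (+ 2) (+ j))
    where
    regroup : ∀ t j → + 0 ℤ.- (t ℤ.+ j) ≡ (+ 0 ℤ.- j) ℤ.- t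
    regroup = solve-∀
  same-parity : Even (+ 0 ℤ.- + (2 + j)) ⇔ Even (+ 0 ℤ.- + j)
  same-parity = subst (λ z → Even z ⇔ Even (+ 0 ℤ.- + j)) (sym shift)
                      (even-shift (+ 0 ℤ.- + j) (+ 2) (ℕD.divides 1 refl))

Λ₀-count : ∀ j → Λ 0 j ↔ Fin (evenIndicator j)
Λ₀-count zero = prop-↔ Λ₀-prop (λ { Fin.zero Fin.zero → refl ; (Fin.suc ()) _ ; _ (Fin.suc ()) })
  (mk⇔ (λ _ → Fin.zero) (λ _ → [] , z≤n , ℕD.divides 0 refl))
Λ₀-count (suc zero) = prop-↔ Λ₀-prop (λ ())
  (mk⇔ (λ { ([] , _ , 2∣1) → ⊥-elim (two≢one (ℕD.∣1⇒≡1 2∣1)) }) (λ ()))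
  where
  two≢one : ¬ (2 ≡ 1)
  two≢one ()
Λ₀-count (suc (suc j)) = ↔-trans (prop-↔ Λ₀-prop Λ₀-prop (Λ₀-shift j)) (Λ₀-count j)

N : ℕ → ℕ → ℕ
N zero    k = evenIndicator k
N (suc d) k = N d k + 2 * sum (map (N d) (upTo k))

Λ-count : ∀ d k → Λ d k ↔ Fin (N d k)
Λ-count zero    k = Λ₀-count k
Λ-count (suc d) k =
  ↔-trans (Λ-suc d k)
  (↔-trans (Λ-count d k ⊎-↔ (shells ⊎-↔ shells))
  (↔-trans (↔-refl ⊎-↔ ↔-sym +↔⊎)
  (↔-trans (↔-sym +↔⊎)
  (Fin-cong (cong (λ x → N d k + (s + x)) (sym (ℕP.+-identityʳ s)))))))
  where
  s = sum (map (N d) (upTo k))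
  shells : Shells (Λ d) k ↔ Fin s
  shells = Shells-count (Λ d) (N d) k (λ j _ → Λ-count d j)

N-radius-0 : ∀ d → N d 0 ≡ 1
N-radius-0 zero    = refl
N-radius-0 (suc d) = trans (ℕP.+-identityʳ (N d 0)) (N-radius-0 d)

N-radius-1 : ∀ d → N d 1 ≡ 2 * d
N-radius-1 zero    = refl
N-radius-1 (suc d) = begin
  N d 1 + 2 * (N d 0 + 0)   ≡⟨ cong₂ (λ u w → u + 2 * (w + 0)) (N-radius-1 d) (N-radius-0 d) ⟩
  2 * d + 2 * (1 + 0)       ≡⟨ add-two d ⟩
  2 * suc d                 ∎
  where
  open ≡-Reasoning
  add-two : ∀ d → 2 * d + 2 * (1 + 0) ≡ 2 * suc d
  add-two = ℕRing.solve-∀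

evenIndicator-pair : ∀ k → evenIndicator (suc k) + evenIndicator k ≡ 1
evenIndicator-pair zero          = refl
evenIndicator-pair (suc zero)    = refl
evenIndicator-pair (suc (suc k)) = evenIndicator-pair k

N-dim-1 : ∀ k → N 1 k ≡ suc k
N-dim-1 zero    = refl
N-dim-1 (suc k) = begin
  e (suc k) + 2 * sum (map e (upTo (suc k)))   ≡⟨ cong (λ u → e (suc k) + 2 * u) (sum-upTo-suc e k) ⟩
  e (suc k) + 2 * (S + e k)                   ≡⟨ regroup (e (suc k)) (e k) S ⟩
  (e (suc k) + e k) + (e k + 2 * S)           ≡⟨ cong₂ _+_ (evenIndicator-pair k) (N-dim-1 k) ⟩
  suc (suc k)                                 ∎
  where
  open ≡-Reasoning
  e = evenIndicator
  S = sum (map e (upTo k))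
  regroup : ∀ a b S → a + 2 * (S + b) ≡ (a + b) + (b + 2 * S)
  regroup = ℕRing.solve-∀

dist-self : ∀ {d} (v : Vec ℤ d) → dist₁ v v ≡ 0
dist-self []      = refl
dist-self (a ∷ v) = cong₂ _+_ (cong ∣_∣ (ℤP.+-inverseʳ a)) (dist-self v)

dist-zero⇒≡ : ∀ {d} (x y : Vec ℤ d) → dist₁ x y ≡ 0 → x ≡ y
dist-zero⇒≡ []      []      _ = refl
dist-zero⇒≡ (a ∷ x) (b ∷ y) e =
  cong₂ _∷_ (ℤP.i-j≡0⇒i≡j a b (ℤP.∣i∣≡0⇒i≡0 (ℕP.m+n≡0⇒m≡0 _ e)))
            (dist-zero⇒≡ x y (ℕP.m+n≡0⇒n≡0 ∣ a ℤ.- b ∣ e))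

dist-bound : ∀ {d} (x y : Vec ℤ d) → dist₁ x y ≤ ‖ x ‖₁ + ‖ y ‖₁
dist-bound []      []      = z≤n
dist-bound (a ∷ x) (b ∷ y) = ℕP.≤-trans
  (ℕP.+-mono-≤ (ℤP.∣i-j∣≤∣i∣+∣j∣ a b) (dist-bound x y))
  (ℕP.≤-reflexive (+-interchange ∣ a ∣ ∣ b ∣ ‖ x ‖₁ ‖ y ‖₁))

coordSum-diff : ∀ {d} (x y : Vec ℤ d) → coordSum (zipWith ℤ._-_ x y) ≡ coordSum x ℤ.- coordSum y
coordSum-diff []      []      = refl
coordSum-diff (a ∷ x) (b ∷ y) =
  trans (cong (ℤ._+_ (a ℤ.- b)) (coordSum-diff x y)) (interchange a b (coordSum x) (coordSum y))
  where
  interchange : ∀ a b s t → (a ℤ.- b) ℤ.+ (s ℤ.- t) ≡ (a ℤ.+ s) ℤ.- (b ℤ.+ t)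
  interchange = solve-∀

dist-even : ∀ {d k} (x y : Vec ℤ d) → InΛ d k x → InΛ d k y → 2 ℕD.∣ dist₁ x y
dist-even {k = k} x y (_ , x-parity) (_ , y-parity) =
  subst Even (sym regroup)
    (even-+ (+ L ℤ.- (coordSum x ℤ.- coordSum y)) ((coordSum x ℤ.- + k) ℤ.- (coordSum y ℤ.- + k))
      norm-vs-sum (even-- (coordSum x ℤ.- + k) (coordSum y ℤ.- + k) x-parity y-parity))
  where
  L = dist₁ x y
  norm-vs-sum : Even (+ L ℤ.- (coordSum x ℤ.- coordSum y))
  norm-vs-sum = subst (λ s → Even (+ L ℤ.- s)) (coordSum-diff x y) (norm-parity (zipWith ℤ._-_ x y))
  regroup : + L ≡ (+ L ℤ.- (coordSum x ℤ.- coordSum y))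
                  ℤ.+ ((coordSum x ℤ.- + k) ℤ.- (coordSum y ℤ.- + k))
  regroup = telescope (+ L) (coordSum x) (coordSum y) (+ k)
    where
    telescope : ∀ L s t k → L ≡ (L ℤ.- (s ℤ.- t)) ℤ.+ ((s ℤ.- k) ℤ.- (t ℤ.- k))
    telescope = solve-∀

determined-distances : ∀ {d k l} → Determines d k l → Σ ℕ λ j → (1 ≤ j) × (j ≤ k) × (l ≡ 2 * j)
determined-distances {k = k} (x , y , x∈Λ , y∈Λ , x≢y , refl) with dist-even x y x∈Λ y∈Λ
... | ℕD.divides j dist≡j*2 = j , positive j dist≡j*2 , j≤k , trans dist≡j*2 (ℕP.*-comm j 2)
  where
  positive : ∀ i → dist₁ x y ≡ i * 2 → 1 ≤ i
  positive zero    dist≡0 = ⊥-elim (x≢y (dist-zero⇒≡ x y dist≡0))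
  positive (suc _) _      = s≤s z≤n
  j≤k : j ≤ k
  j≤k = ℕP.*-cancelˡ-≤ 2 (begin
    2 * j              ≡⟨ trans (ℕP.*-comm 2 j) (sym dist≡j*2) ⟩
    dist₁ x y          ≤⟨ dist-bound x y ⟩
    ‖ x ‖₁ + ‖ y ‖₁    ≤⟨ ℕP.+-mono-≤ (proj₁ x∈Λ) (proj₁ y∈Λ) ⟩
    k + k              ≡⟨ cong (_+_ k) (ℕP.+-identityʳ k) ⟨
    2 * k              ∎)
    where open ℕP.≤-Reasoning

zeros : ∀ d → Vec ℤ d
zeros d = replicate d (+ 0)

axis-point-mem : ∀ d {k} a → ∣ a ∣ ≤ k → Even (a ℤ.- + k) → InΛ (suc d) k (a ∷ zeros d)
axis-point-mem d {k} a bound parity =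
  subst (_≤ k) (sym (trans (cong (_+_ ∣ a ∣) (norm-zeros d)) (ℕP.+-identityʳ ∣ a ∣))) bound ,
  subst (λ z → Even (z ℤ.- + k)) (sym (trans (cong (ℤ._+_ a) (sum-zeros d)) (ℤP.+-identityʳ a))) parity
  where
  norm-zeros : ∀ n → ‖ zeros n ‖₁ ≡ 0
  norm-zeros zero    = refl
  norm-zeros (suc n) = norm-zeros n
  sum-zeros : ∀ n → coordSum (zeros n) ≡ + 0
  sum-zeros zero    = refl
  sum-zeros (suc n) = cong (ℤ._+_ (+ 0)) (sum-zeros n)

distance-realised : ∀ d t j → 1 ≤ j → Determines (suc d) (t + j) (2 * j)
distance-realised d t j 1≤j = x , y , x∈Λ , y∈Λ , x≢y , dist≡2j
  where
  x y : Vec ℤ (suc d)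
  x = + (t + j) ∷ zeros d
  y = (+ t ℤ.- + j) ∷ zeros d
  x∈Λ : InΛ (suc d) (t + j) x
  x∈Λ = axis-point-mem d (+ (t + j)) ℕP.≤-refl
          (subst Even (sym (ℤP.+-inverseʳ (+ (t + j)))) (ℕD.divides 0 refl))
  y∈Λ : InΛ (suc d) (t + j) y
  y∈Λ = axis-point-mem d (+ t ℤ.- + j) (ℤP.∣i-j∣≤∣i∣+∣j∣ (+ t) (+ j))
          (subst Even (sym y-offset) (from (even-shift (+ 0) (+ j ℤ.+ + j) (even-double (+ j))) (ℕD.divides 0 refl)))
    where
    y-offset : (+ t ℤ.- + j) ℤ.- + (t + j) ≡ + 0 ℤ.- (+ j ℤ.+ + j)
    y-offset = trans (cong (ℤ._-_ (+ t ℤ.- + j)) (ℤP.pos-+ t j)) (regroup (+ t) (+ j))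
      where
      regroup : ∀ t j → (t ℤ.- j) ℤ.- (t ℤ.+ j) ≡ + 0 ℤ.- (j ℤ.+ j)
      regroup = solve-∀
  head-gap : ∣ + (t + j) ℤ.- (+ t ℤ.- + j) ∣ ≡ j + j
  head-gap = cong ∣_∣ (begin
    + (t + j) ℤ.- (+ t ℤ.- + j)       ≡⟨ cong (ℤ._- (+ t ℤ.- + j)) (ℤP.pos-+ t j) ⟩
    (+ t ℤ.+ + j) ℤ.- (+ t ℤ.- + j)   ≡⟨ regroup (+ t) (+ j) ⟩
    + j ℤ.+ + j                       ≡⟨ ℤP.pos-+ j j ⟨
    + (j + j)                         ∎)
    where
    open ≡-Reasoning
    regroup : ∀ t j → (t ℤ.+ j) ℤ.- (t ℤ.- j) ≡ j ℤ.+ j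
    regroup = solve-∀
  dist≡2j : dist₁ x y ≡ 2 * j
  dist≡2j = trans (cong₂ _+_ head-gap (dist-self (zeros d))) (ℕP.+-assoc j j 0)
  x≢y : ¬ (x ≡ y)
  x≢y x≡y = double-nonzero j 1≤j (trans (sym dist≡2j) (trans (cong (dist₁ x) (sym x≡y)) (dist-self x)))
    where
    double-nonzero : ∀ i → 1 ≤ i → ¬ (2 * i ≡ 0)
    double-nonzero (suc _) _ ()

theorem2p2 : (d k : ℕ) → 1 ≤ d → 1 ≤ k →
    ((l : ℕ) → Determines d k l ⇔ (Σ ℕ λ j → (1 ≤ j) × (j ≤ k) × (l ≡ 2 * j)))
    × (Λ 1 k ↔ Fin (suc k))
    × (Λ d 1 ↔ Fin (2 * d))
    × (Σ (ℕ → ℕ) λ c → ((j : ℕ) → j ≤ k → Λ d j ↔ Fin (c j))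
         × (Λ (suc d) k ↔ Fin (c k + 2 * sum (map c (upTo k)))))
theorem2p2 (suc d) k _ _ =
  (λ l → mk⇔ determined-distances realised) ,
  ↔-trans (Λ-count 1 k) (Fin-cong (N-dim-1 k)) ,
  ↔-trans (Λ-count (suc d) 1) (Fin-cong (N-radius-1 (suc d))) ,
  (N (suc d) , (λ j _ → Λ-count (suc d) j) , Λ-count (suc (suc d)) k)
  where
  realised : ∀ {l} → (Σ ℕ λ j → (1 ≤ j) × (j ≤ k) × (l ≡ 2 * j)) → Determines (suc d) k l
  realised (j , 1≤j , j≤k , refl) =
    subst (λ k′ → Determines (suc d) k′ (2 * j)) (ℕP.m∸n+n≡m j≤k) (distance-realised d (k ∸ j) j 1≤j)
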